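{- For any integers $a,b,q$ with $q\ge1$, the number $N(a,b;q)$ of pairs of residues $(\gamma_1,\gamma_2)$ modulo $q$ satisfying $a\gamma_1^2\equiv b\gamma_2^2\pmod q$ satisfies $$N(a,b;q)\le([a,b],q)\,q\,\tau(q),$$ where $[a,b]$ is the least common multiple of $a$ and $b$.
   Context: $\tau$ is the divisor function and $(\cdot,\cdot)$ the greatest common divisor. -}

module Defs where

open import Data.Nat using (ℕ; suc; _≤_)
open import Data.Nat.Divisibility using (_∣?_)
open import Data.Nat.GCD using (gcd)
open import Data.Integer using (ℤ; +_; _*_; _-_; ∣_∣)
open import Data.Integer.LCM using (lcm)
open import Data.Fin using (Fin; toℕ)
open import Data.List using (List; length; filter; map; upTo; cartesianProduct)
open import Data.List using (allFin)
open import Data.Product using (_×_; _,_)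
open import Relation.Nullary using (Dec)

_≡_[mod_]? : (x y : ℤ) (q : ℕ) → Dec (q Data.Nat.Divisibility.∣ ∣ x - y ∣)
x ≡ y [mod q ]? = q ∣? ∣ x - y ∣

N : ℤ → ℤ → ℕ → ℕ
N a b q = length (filter (λ { (g₁ , g₂) → (a * (+ toℕ g₁) * (+ toℕ g₁)) ≡ (b * (+ toℕ g₂) * (+ toℕ g₂)) [mod q ]? })
                         (cartesianProduct (allFin q) (allFin q)))

τ : ℕ → ℕ
τ q = length (filter (λ d → d ∣? q) (map suc (upTo q)))

lcmGcd : ℤ → ℤ → ℕ → ℕ
lcmGcd a b q = gcd ∣ lcm a b ∣ q

-- Writing α_U(c) for the number of x mod q with U(x) ≡ c, the pair count is
-- N(a,b;q) = ∑_c α_{ax²}(c) α_{bx²}(c), so 2 N(a,b;q) ≤ N(a,a;q) + N(b,b;q) since 2st ≤ s² + t².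
-- With g = (a,q) and q = g q′ we have a x² ≡ a y² (mod q) iff x² ≡ y² (mod q′), hence
-- N(a,a;q) = g² N(1,1;q′).  Putting y = x + d, N(1,1;m) = ∑_d #{x : m ∣ d (2x + d)}.
-- If (d,m) = E and m = E f, the condition reads f ∣ 2x + d.  For f odd it has at most E
-- solutions and at most f values of d have (d,m) = E; for f even it has at most 2E solutions,
-- but then d is an odd multiple of E, which leaves at most f/2 values of d.  Either way each
-- divisor E of m contributes at most m, so N(1,1;m) ≤ τ(m) m, and finally
-- N(a,a;q) ≤ g² τ(q′) q′ ≤ (a,q) q τ(q) ≤ ([a,b],q) q τ(q).

module Submission where

open import Defs
open import Data.Nat using (ℕ; _≤_; _*_)
open import Data.Integer using (ℤ)

open import Data.Empty using (⊥-elim)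
open import Data.Fin.Base using (toℕ)
open import Data.List.Base using ([]; _∷_; _++_; length; filter; map; applyUpTo; upTo; tabulate; allFin; cartesianProduct)
open import Data.List.Properties using (map-++; map-∘; map-cong; map-tabulate; map-upTo)
open import Data.Nat.Base as ℕ using (zero; suc; _+_; _∸_; _<_; z≤n; s≤s; z<s; s<s; NonZero; ≢-nonZero; ≢-nonZero⁻¹)
open import Data.Nat.Coprimality using (Coprime; gcd≡1⇒coprime; coprime-divisor)
open import Data.Nat.Divisibility
  using ( _∣_; _∣?_; divides; quotient; quotient≢0; quotient-∣; ∣-refl; ∣-trans; _∣0; 0∣⇒≡0; ∣⇒≤; >⇒∤
        ; m∣m*n; n∣m*n; ∣m∣n⇒∣m+n; ∣m+n∣m⇒∣n; m∣n⇒n≡m*quotient; *-pres-∣; *-cancelˡ-∣)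
open import Data.Nat.GCD
  using (gcd; gcd[m,n]∣m; gcd[m,n]∣n; gcd[m,n]≢0; gcd[m,n]≤n; gcd-greatest; gcd-comm; c*gcd[m,n]≡gcd[cm,cn])
open import Data.Nat.ListAction using (sum)
open import Data.Nat.ListAction.Properties using (sum-++)
open import Data.Nat.Properties
open import Data.Nat.Tactic.RingSolver using (solve-∀)
open import Data.Product using (_×_; _,_; proj₁; proj₂)
open import Data.Product.Function.NonDependent.Propositional using (_×-⇔_)
open import Data.Sum using (inj₁; inj₂; [_,_]′)
open import Function using (id; _∘_; _⇔_; mk⇔; Equivalence)
open import Function.Related.TypeIsomorphisms using (¬-cong-⇔)
open import Relation.Binary.PropositionalEquality
open import Relation.Nullary using (Dec; yes; no; ¬_; contradiction)
open import Relation.Nullary.Decidable using (map′; _×-dec_; ¬?)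
open import Relation.Unary using (Decidable)

private variable
  P Q : Set
  f h : ℕ → ℕ
  R : ℕ → Set
  i j n p q : ℕ

-- Indicators and finite sums

𝟙 : Dec P → ℕ
𝟙 (yes _) = 1
𝟙 (no _)  = 0

𝟙-cong : P ⇔ Q → (P? : Dec P) (Q? : Dec Q) → 𝟙 P? ≡ 𝟙 Q?
𝟙-cong _   (yes _) (yes _) = refl
𝟙-cong P⇔Q (yes p) (no ¬q) = ⊥-elim (¬q (Equivalence.to P⇔Q p))
𝟙-cong P⇔Q (no ¬p) (yes q) = ⊥-elim (¬p (Equivalence.from P⇔Q q))
𝟙-cong _   (no _)  (no _)  = refl

𝟙-mono : (P → Q) → (P? : Dec P) (Q? : Dec Q) → 𝟙 P? ≤ 𝟙 Q?
𝟙-mono _   (yes _) (yes _) = ≤-refl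
𝟙-mono P⇒Q (yes p) (no ¬q) = ⊥-elim (¬q (P⇒Q p))
𝟙-mono _   (no _)  _       = z≤n

𝟙-yes : (P? : Dec P) → P → 𝟙 P? ≡ 1
𝟙-yes (yes _) _ = refl
𝟙-yes (no ¬p) p = ⊥-elim (¬p p)

𝟙-no : (P? : Dec P) → ¬ P → 𝟙 P? ≡ 0
𝟙-no (yes p) ¬p = ⊥-elim (¬p p)
𝟙-no (no _)  _  = refl

𝟙*-mono : ∀ {a b} → (P → Q) → (P → a ≤ b) → (P? : Dec P) (Q? : Dec Q) → 𝟙 P? * a ≤ 𝟙 Q? * b
𝟙*-mono _   a≤b (yes p) (yes _) = +-monoˡ-≤ 0 (a≤b p)
𝟙*-mono P⇒Q _   (yes p) (no ¬q) = ⊥-elim (¬q (P⇒Q p))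
𝟙*-mono _   _   (no _)  _       = z≤n

∑< : ℕ → (ℕ → ℕ) → ℕ
∑< n f = sum (applyUpTo f n)

syntax ∑< n (λ i → e) = ∑[ i < n ] e

Periodic : ℕ → (ℕ → ℕ) → Set
Periodic p f = ∀ i → f (p + i) ≡ f i

∑-cong : ∀ n → (∀ i → i < n → f i ≡ h i) → ∑< n f ≡ ∑< n h
∑-cong zero    _   = refl
∑-cong (suc n) f≡h = cong₂ _+_ (f≡h 0 z<s) (∑-cong n (λ i i<n → f≡h (suc i) (s<s i<n)))

∑-mono-≤ : ∀ n → (∀ i → i < n → f i ≤ h i) → ∑< n f ≤ ∑< n h
∑-mono-≤ zero    _   = z≤n
∑-mono-≤ (suc n) f≤h = +-mono-≤ (f≤h 0 z<s) (∑-mono-≤ n (λ i i<n → f≤h (suc i) (s<s i<n)))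

∑-zero : ∀ n → (∀ i → i < n → f i ≡ 0) → ∑< n f ≡ 0
∑-zero zero    _    = refl
∑-zero (suc n) f≡0 = cong₂ _+_ (f≡0 0 z<s) (∑-zero n (λ i i<n → f≡0 (suc i) (s<s i<n)))

∑-distrib-+ : ∀ n → ∑[ i < n ] (f i + h i) ≡ ∑< n f + ∑< n h
∑-distrib-+ zero    = refl
∑-distrib-+ {f} {h} (suc n) = begin
  (f 0 + h 0) + ∑[ i < n ] (f (suc i) + h (suc i))  ≡⟨ cong ((f 0 + h 0) +_) (∑-distrib-+ n) ⟩
  (f 0 + h 0) + (∑< n (f ∘ suc) + ∑< n (h ∘ suc))    ≡⟨ +-interchange (f 0) (h 0) _ _ ⟩
  (f 0 + ∑< n (f ∘ suc)) + (h 0 + ∑< n (h ∘ suc))    ∎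
  where
  open ≡-Reasoning
  +-interchange : ∀ a b c d → (a + b) + (c + d) ≡ (a + c) + (b + d)
  +-interchange = solve-∀

∑-distribˡ-* : ∀ c n → c * ∑< n f ≡ ∑[ i < n ] (c * f i)
∑-distribˡ-* c zero    = *-zeroʳ c
∑-distribˡ-* {f} c (suc n) = trans (*-distribˡ-+ c (f 0) _) (cong (c * f 0 +_) (∑-distribˡ-* c n))

∑-distribʳ-* : ∀ c n → ∑< n f * c ≡ ∑[ i < n ] (f i * c)
∑-distribʳ-* {f} c n = begin
  ∑< n f * c           ≡⟨ *-comm (∑< n f) c ⟩
  c * ∑< n f           ≡⟨ ∑-distribˡ-* c n ⟩
  ∑[ i < n ] (c * f i) ≡⟨ ∑-cong n (λ i _ → *-comm c (f i)) ⟩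
  ∑[ i < n ] (f i * c) ∎
  where open ≡-Reasoning

∑-comm : ∀ m n (F : ℕ → ℕ → ℕ) → ∑[ i < m ] ∑[ j < n ] F i j ≡ ∑[ j < n ] ∑[ i < m ] F i j
∑-comm zero    n F = sym (∑-zero n (λ _ _ → refl))
∑-comm (suc m) n F = begin
  ∑< n (F 0) + ∑[ i < m ] ∑[ j < n ] F (suc i) j  ≡⟨ cong (∑< n (F 0) +_) (∑-comm m n (F ∘ suc)) ⟩
  ∑< n (F 0) + ∑[ j < n ] ∑[ i < m ] F (suc i) j  ≡⟨ ∑-distrib-+ n ⟨
  ∑[ j < n ] ∑[ i < suc m ] F i j                 ∎
  where open ≡-Reasoning

∑-+ : ∀ m n → ∑< (m + n) f ≡ ∑< m f + ∑[ i < n ] f (m + i)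
∑-+ zero    n = refl
∑-+ {f} (suc m) n = trans (cong (f 0 +_) (∑-+ m n)) (sym (+-assoc (f 0) _ _))

∑-mono-≤-range : ∀ {m n} → m ≤ n → ∑< m f ≤ ∑< n f
∑-mono-≤-range z≤n       = z≤n
∑-mono-≤-range {f} (s≤s m≤n) = +-monoʳ-≤ (f 0) (∑-mono-≤-range m≤n)

∑-periodic : ∀ p k → Periodic p f → ∑< (k * p) f ≡ k * ∑< p f
∑-periodic p zero    _     = refl
∑-periodic {f} p (suc k) per = begin
  ∑< (p + k * p) f                      ≡⟨ ∑-+ p (k * p) ⟩
  ∑< p f + ∑[ i < k * p ] f (p + i)     ≡⟨ cong (∑< p f +_) (∑-cong (k * p) (λ i _ → per i)) ⟩
  ∑< p f + ∑< (k * p) f                 ≡⟨ cong (∑< p f +_) (∑-periodic p k per) ⟩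
  ∑< p f + k * ∑< p f                   ∎
  where open ≡-Reasoning

∑-rotate₁ : ∀ p → Periodic p f → ∑< p (f ∘ suc) ≡ ∑< p f
∑-rotate₁ {f} p per = +-cancelˡ-≡ (f 0) _ _ (begin
  ∑< (1 + p) f                 ≡⟨ cong (λ n → ∑< n f) (+-comm 1 p) ⟩
  ∑< (p + 1) f                 ≡⟨ ∑-+ p 1 ⟩
  ∑< p f + (f (p + 0) + 0)     ≡⟨ cong (λ x → ∑< p f + (x + 0)) (per 0) ⟩
  ∑< p f + (f 0 + 0)           ≡⟨ cong (∑< p f +_) (+-identityʳ (f 0)) ⟩
  ∑< p f + f 0                 ≡⟨ +-comm (∑< p f) (f 0) ⟩
  f 0 + ∑< p f                 ∎)
  where open ≡-Reasoning

∑-rotate : ∀ p c → Periodic p f → ∑[ i < p ] f (c + i) ≡ ∑< p f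
∑-rotate p zero    _   = refl
∑-rotate {f} p (suc c) per = trans (∑-rotate p c per∘suc) (∑-rotate₁ p per)
  where
  per∘suc : Periodic p (f ∘ suc)
  per∘suc i = trans (cong f (sym (+-suc p i))) (per (suc i))

∑-delta : ∀ n r → r < n → (∀ i → i < n → i ≢ r → f i ≡ 0) → ∑< n f ≡ f r
∑-delta {f} (suc n) zero    _         off =
  trans (cong (f 0 +_) (∑-zero n (λ i i<n → off (suc i) (s<s i<n) λ ()))) (+-identityʳ (f 0))
∑-delta     (suc n) (suc r) (s<s r<n) off =
  cong₂ _+_ (off 0 z<s λ ()) (∑-delta n r r<n (λ i i<n i≢r → off (suc i) (s<s i<n) (i≢r ∘ suc-injective)))

∑-𝟙-≤1 : ∀ n (R? : Decidable R) → (∀ {i j} → i < n → j < n → R i → R j → i ≡ j) → ∑[ i < n ] 𝟙 (R? i) ≤ 1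
∑-𝟙-≤1 zero    R? unique = z≤n
∑-𝟙-≤1 (suc n) R? unique with R? 0
... | yes r0 = s≤s (≤-reflexive (∑-zero n (λ i i<n → 𝟙-no (R? (suc i)) (λ ri → 1+n≢0 (unique (s<s i<n) z<s ri r0)))))
... | no _   = ∑-𝟙-≤1 n (R? ∘ suc) (λ i<n j<n ri rj → suc-injective (unique (s<s i<n) (s<s j<n) ri rj))

∑-𝟙-periodic-≤ : ∀ p k (R? : Decidable R) → (∀ i → R (p + i) ⇔ R i) →
                 (∀ {i j} → i < p → j < p → R i → R j → i ≡ j) → ∑[ i < k * p ] 𝟙 (R? i) ≤ k
∑-𝟙-periodic-≤ p k R? per unique = begin
  ∑[ i < k * p ] 𝟙 (R? i)  ≡⟨ ∑-periodic p k (λ i → 𝟙-cong (per i) (R? (p + i)) (R? i)) ⟩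
  k * ∑[ i < p ] 𝟙 (R? i)  ≤⟨ *-monoʳ-≤ k (∑-𝟙-≤1 p R? unique) ⟩
  k * 1                    ≡⟨ *-identityʳ k ⟩
  k                        ∎
  where open ≤-Reasoning

∑∑-periodic : ∀ p k (F : ℕ → ℕ → ℕ) → (∀ x → Periodic p (F x)) → (∀ y → Periodic p (λ x → F x y)) →
              ∑[ x < k * p ] ∑[ y < k * p ] F x y ≡ k * (k * ∑[ x < p ] ∑[ y < p ] F x y)
∑∑-periodic p k F periodicʸ periodicˣ = begin
  ∑[ x < k * p ] ∑[ y < k * p ] F x y       ≡⟨ ∑-cong (k * p) (λ x _ → ∑-periodic p k (periodicʸ x)) ⟩
  ∑[ x < k * p ] (k * ∑[ y < p ] F x y)     ≡⟨ ∑-distribˡ-* k (k * p) ⟨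
  k * ∑[ x < k * p ] ∑[ y < p ] F x y       ≡⟨ cong (k *_) (∑-periodic p k (λ x → ∑-cong p (λ y _ → periodicˣ y x))) ⟩
  k * (k * ∑[ x < p ] ∑[ y < p ] F x y)     ∎
  where open ≡-Reasoning

length-filter≡sum-𝟙 : ∀ {A : Set} {P : A → Set} (P? : Decidable P) xs → length (filter P? xs) ≡ sum (map (𝟙 ∘ P?) xs)
length-filter≡sum-𝟙 P? []       = refl
length-filter≡sum-𝟙 P? (x ∷ xs) with P? x
... | yes _ = cong suc (length-filter≡sum-𝟙 P? xs)
... | no _  = length-filter≡sum-𝟙 P? xs

sum-map-cartesianProduct : ∀ {A B : Set} (h : A × B → ℕ) xs ys →
  sum (map h (cartesianProduct xs ys)) ≡ sum (map (λ x → sum (map (λ y → h (x , y)) ys)) xs)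
sum-map-cartesianProduct h []       ys = refl
sum-map-cartesianProduct h (x ∷ xs) ys = begin
  sum (map h (map (x ,_) ys ++ cartesianProduct xs ys))                   ≡⟨ cong sum (map-++ h (map (x ,_) ys) _) ⟩
  sum (map h (map (x ,_) ys) ++ map h (cartesianProduct xs ys))           ≡⟨ sum-++ (map h (map (x ,_) ys)) _ ⟩
  sum (map h (map (x ,_) ys)) + sum (map h (cartesianProduct xs ys))
    ≡⟨ cong₂ _+_ (cong sum (sym (map-∘ ys))) (sum-map-cartesianProduct h xs ys) ⟩
  sum (map (λ y → h (x , y)) ys) + sum (map (λ x → sum (map (λ y → h (x , y)) ys)) xs) ∎
  where open ≡-Reasoning

tabulate-toℕ : ∀ n (h : ℕ → ℕ) → tabulate {n = n} (h ∘ toℕ) ≡ applyUpTo h n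
tabulate-toℕ zero    h = refl
tabulate-toℕ (suc n) h = cong (h 0 ∷_) (tabulate-toℕ n (h ∘ suc))

sum-map-allFin : ∀ n (h : ℕ → ℕ) → sum (map (h ∘ toℕ) (allFin n)) ≡ ∑< n h
sum-map-allFin n h = cong sum (trans (map-tabulate id (h ∘ toℕ)) (tabulate-toℕ n h))

τ≡∑ : ∀ q → τ q ≡ ∑[ i < q ] 𝟙 (suc i ∣? q)
τ≡∑ q = begin
  length (filter (_∣? q) (map suc (upTo q)))         ≡⟨ length-filter≡sum-𝟙 (_∣? q) (map suc (upTo q)) ⟩
  sum (map (𝟙 ∘ (_∣? q)) (map suc (upTo q)))         ≡⟨ cong sum (map-∘ (upTo q)) ⟨
  sum (map (𝟙 ∘ (_∣? q) ∘ suc) (upTo q))             ≡⟨ cong sum (map-upTo _ q) ⟩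
  ∑[ i < q ] 𝟙 (suc i ∣? q)                          ∎
  where open ≡-Reasoning

τ-mono-∣ : ∀ {m n} .{{_ : NonZero n}} → m ∣ n → τ m ≤ τ n
τ-mono-∣ {m} {n} m∣n = begin
  τ m                          ≡⟨ τ≡∑ m ⟩
  ∑[ i < m ] 𝟙 (suc i ∣? m)    ≤⟨ ∑-mono-≤ m (λ i _ → 𝟙-mono (λ i∣m → ∣-trans i∣m m∣n) _ _) ⟩
  ∑[ i < m ] 𝟙 (suc i ∣? n)    ≤⟨ ∑-mono-≤-range (∣⇒≤ m∣n) ⟩
  ∑[ i < n ] 𝟙 (suc i ∣? n)    ≡⟨ τ≡∑ n ⟨
  τ n                          ∎
  where open ≤-Reasoning

-- Divisibility

m∣n<m⇒n≡0 : p ∣ n → n < p → n ≡ 0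
m∣n<m⇒n≡0 {n = zero}  _   _   = refl
m∣n<m⇒n≡0 {n = suc _} p∣n n<p = contradiction p∣n (>⇒∤ n<p)

∣∸⇒unique-below : (∀ {i j} → i ≤ j → R i → R j → p ∣ j ∸ i) → i < p → j < p → R i → R j → i ≡ j
∣∸⇒unique-below {i = i} {j = j} ∣∸ i<p j<p ri rj with ≤-total i j
... | inj₁ i≤j = ≤-antisym i≤j (m∸n≡0⇒m≤n (m∣n<m⇒n≡0 (∣∸ i≤j ri rj) (≤-<-trans (m∸n≤m j i) j<p)))
... | inj₂ j≤i = sym (≤-antisym j≤i (m∸n≡0⇒m≤n (m∣n<m⇒n≡0 (∣∸ j≤i rj ri) (≤-<-trans (m∸n≤m i j) i<p))))

∣m∣n⇒∣n∸m : ∀ {k m n} → k ∣ m → k ∣ n → k ∣ n ∸ m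
∣m∣n⇒∣n∸m {k} {m} {n} k∣m k∣n with ≤-total m n
... | inj₁ m≤n = ∣m+n∣m⇒∣n (subst (k ∣_) (sym (m+[n∸m]≡n m≤n)) k∣n) k∣m
... | inj₂ n≤m = subst (k ∣_) (sym (m≤n⇒m∸n≡0 n≤m)) (k ∣0)

∣m⇒[∣m+n⇔∣n] : ∀ {k m n} → k ∣ m → (k ∣ m + n ⇔ k ∣ n)
∣m⇒[∣m+n⇔∣n] k∣m = mk⇔ (λ k∣m+n → ∣m+n∣m⇒∣n k∣m+n k∣m) (∣m∣n⇒∣m+n k∣m)

odd⇒coprime-2 : ∀ {f} → ¬ (2 ∣ f) → Coprime f 2
odd⇒coprime-2 2∤f {0}                   (_ , 0∣2)  = contradiction (0∣⇒≡0 0∣2) λ ()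
odd⇒coprime-2 2∤f {1}                   _          = refl
odd⇒coprime-2 2∤f {2}                   (2∣f , _)  = contradiction 2∣f 2∤f
odd⇒coprime-2 2∤f {suc (suc (suc _))}   (_ , d∣2)  = contradiction (∣⇒≤ d∣2) λ { (s≤s (s≤s ())) }

∣*⇔cofactor∣ : ∀ {A q g q′} z .{{_ : NonZero g}} → gcd A q ≡ g → q ≡ g * q′ → (q ∣ A * z ⇔ q′ ∣ z)
∣*⇔cofactor∣ {A} {q} {g} {q′} z gcd≡g q≡gq′ = mk⇔ to from
  where
  g∣A : g ∣ A
  g∣A = subst (_∣ A) gcd≡g (gcd[m,n]∣m A q)
  A′ : ℕ
  A′ = quotient g∣A
  A≡gA′ : A ≡ g * A′
  A≡gA′ = m∣n⇒n≡m*quotient g∣A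
  coprime : Coprime q′ A′
  coprime = gcd≡1⇒coprime (*-cancelˡ-≡ _ _ g (begin
    g * gcd q′ A′          ≡⟨ c*gcd[m,n]≡gcd[cm,cn] g q′ A′ ⟩
    gcd (g * q′) (g * A′)  ≡⟨ cong₂ gcd q≡gq′ A≡gA′ ⟨
    gcd q A                ≡⟨ gcd-comm q A ⟩
    gcd A q                ≡⟨ gcd≡g ⟩
    g                      ≡⟨ *-identityʳ g ⟨
    g * 1                  ∎))
    where open ≡-Reasoning
  to : q ∣ A * z → q′ ∣ z
  to q∣Az = coprime-divisor coprime (*-cancelˡ-∣ g (subst₂ _∣_ q≡gq′ (trans (cong (_* z) A≡gA′) (*-assoc g A′ z)) q∣Az))
  from : q′ ∣ z → q ∣ A * z
  from q′∣z = subst (_∣ A * z) (sym q≡gq′) (*-pres-∣ g∣A q′∣z)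

gcd≡⇒∣ : ∀ {d m E} → gcd d m ≡ E → E ∣ d
gcd≡⇒∣ {d} {m} gcd≡E = subst (_∣ d) gcd≡E (gcd[m,n]∣m d m)

-- Counting x² ≡ y² (mod m)

∑-𝟙-∣2x+d-≤ : ∀ {f p} k d → f ∣ 2 * p → (∀ {n} → f ∣ 2 * n → p ∣ n) → ∑[ x < k * p ] 𝟙 (f ∣? 2 * x + d) ≤ k
∑-𝟙-∣2x+d-≤ {f} {p} k d f∣2p halve = ∑-𝟙-periodic-≤ p k (λ x → f ∣? 2 * x + d) periodic (∣∸⇒unique-below differ)
  where
  shift : ∀ p x d → 2 * (p + x) + d ≡ 2 * p + (2 * x + d)
  shift = solve-∀
  periodic : ∀ x → f ∣ 2 * (p + x) + d ⇔ f ∣ 2 * x + d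
  periodic x = subst (λ n → f ∣ n ⇔ f ∣ 2 * x + d) (sym (shift p x d)) (∣m⇒[∣m+n⇔∣n] f∣2p)
  difference : ∀ i j → (2 * j + d) ∸ (2 * i + d) ≡ 2 * (j ∸ i)
  difference i j = begin
    (2 * j + d) ∸ (2 * i + d)  ≡⟨ cong₂ _∸_ (+-comm (2 * j) d) (+-comm (2 * i) d) ⟩
    (d + 2 * j) ∸ (d + 2 * i)  ≡⟨ [m+n]∸[m+o]≡n∸o d (2 * j) (2 * i) ⟩
    2 * j ∸ 2 * i              ≡⟨ *-distribˡ-∸ 2 j i ⟨
    2 * (j ∸ i)                ∎
    where open ≡-Reasoning
  differ : ∀ {i j} → i ≤ j → f ∣ 2 * i + d → f ∣ 2 * j + d → p ∣ j ∸ i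
  differ {i} {j} _ f∣i f∣j = halve (subst (f ∣_) (difference i j) (∣m∣n⇒∣n∸m f∣i f∣j))

shiftSolutions : ℕ → ℕ → ℕ
shiftSolutions m d = ∑[ x < m ] 𝟙 (m ∣? d * (2 * x + d))

shiftSolutions-≤ : ∀ {m d E f p} k .{{_ : NonZero E}} → gcd d m ≡ E → m ≡ E * f → m ≡ k * p →
                   f ∣ 2 * p → (∀ {n} → f ∣ 2 * n → p ∣ n) → shiftSolutions m d ≤ k
shiftSolutions-≤ {m} {d} {E} {f} {p} k gcd≡E m≡Ef m≡kp f∣2p halve = begin
  ∑[ x < m ] 𝟙 (m ∣? d * (2 * x + d))  ≤⟨ ∑-mono-≤ m (λ x _ → 𝟙-mono (Equivalence.to (∣*⇔cofactor∣ {d} (2 * x + d) gcd≡E m≡Ef)) _ _) ⟩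
  ∑[ x < m ] 𝟙 (f ∣? 2 * x + d)        ≡⟨ cong (λ n → ∑[ x < n ] 𝟙 (f ∣? 2 * x + d)) m≡kp ⟩
  ∑[ x < k * p ] 𝟙 (f ∣? 2 * x + d)    ≤⟨ ∑-𝟙-∣2x+d-≤ k d f∣2p halve ⟩
  k                                    ∎
  where open ≤-Reasoning

divisorClass : ℕ → ℕ → ℕ
divisorClass m E = ∑[ d < m ] (𝟙 (gcd d m ≟ E) * shiftSolutions m d)

divisorClass-≤-periodic : ∀ {m E} (R? : Decidable R) p k K → (∀ i → R (p + i) ⇔ R i) →
                          (∀ {i j} → i < p → j < p → R i → R j → i ≡ j) → m ≡ k * p →
                          (∀ d → gcd d m ≡ E → R d × shiftSolutions m d ≤ K) → divisorClass m E ≤ k * K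
divisorClass-≤-periodic {m = m} {E} R? p k K periodic unique m≡kp bound = begin
  ∑[ d < m ] (𝟙 (gcd d m ≟ E) * shiftSolutions m d)
    ≤⟨ ∑-mono-≤ m (λ d _ → 𝟙*-mono (proj₁ ∘ bound d) (proj₂ ∘ bound d) (gcd d m ≟ E) (R? d)) ⟩
  ∑[ d < m ] (𝟙 (R? d) * K)      ≡⟨ ∑-distribʳ-* K m ⟨
  ∑[ d < m ] 𝟙 (R? d) * K        ≡⟨ cong (λ n → ∑[ d < n ] 𝟙 (R? d) * K) m≡kp ⟩
  ∑[ d < k * p ] 𝟙 (R? d) * K    ≤⟨ *-monoˡ-≤ K (∑-𝟙-periodic-≤ p k R? periodic unique) ⟩
  k * K                          ∎
  where open ≤-Reasoning

divisorClass-≤-odd : ∀ m E f .{{_ : NonZero E}} → m ≡ E * f → ¬ (2 ∣ f) → divisorClass m E ≤ m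
divisorClass-≤-odd m E f m≡Ef 2∤f = subst (divisorClass m E ≤_) (trans (*-comm f E) (sym m≡Ef))
  (divisorClass-≤-periodic (E ∣?_) E f E (λ _ → ∣m⇒[∣m+n⇔∣n] ∣-refl) (∣∸⇒unique-below (λ _ → ∣m∣n⇒∣n∸m))
                           (trans m≡Ef (*-comm E f)) bound)
  where
  bound : ∀ d → gcd d m ≡ E → E ∣ d × shiftSolutions m d ≤ E
  bound d gcd≡E = gcd≡⇒∣ gcd≡E , shiftSolutions-≤ {d = d} E gcd≡E m≡Ef m≡Ef (n∣m*n 2) (coprime-divisor (odd⇒coprime-2 2∤f))

oddMultiple<2E⇒≡E : ∀ {E d} → E ∣ d → ¬ (2 * E ∣ d) → d < 2 * E → d ≡ E
oddMultiple<2E⇒≡E {E} (divides 0 refl)             2E∤d _    = contradiction ((2 * E) ∣0) 2E∤d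
oddMultiple<2E⇒≡E {E} (divides 1 refl)             _    _    = +-identityʳ E
oddMultiple<2E⇒≡E {E} (divides (suc (suc t)) refl) _    d<2E =
  contradiction d<2E (≤⇒≯ (*-monoˡ-≤ E {2} {suc (suc t)} (s≤s (s≤s z≤n))))

divisorClass-≤-even : ∀ m E h .{{_ : NonZero E}} → m ≡ E * (2 * h) → divisorClass m E ≤ m
divisorClass-≤-even m E h m≡E2h = subst (divisorClass m E ≤_) (sym m≡h2E)
  (divisorClass-≤-periodic (λ d → E ∣? d ×-dec ¬? (2 * E ∣? d)) (2 * E) h (2 * E)
                           (λ _ → ∣m⇒[∣m+n⇔∣n] (n∣m*n 2) ×-⇔ ¬-cong-⇔ (∣m⇒[∣m+n⇔∣n] ∣-refl))
                           (λ i<2E j<2E (E∣i , 2E∤i) (E∣j , 2E∤j) →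
                              trans (oddMultiple<2E⇒≡E E∣i 2E∤i i<2E) (sym (oddMultiple<2E⇒≡E E∣j 2E∤j j<2E)))
                           m≡h2E bound)
  where
  m≡h2E : m ≡ h * (2 * E)
  m≡h2E = trans m≡E2h (reorder E h)
    where
    reorder : ∀ E h → E * (2 * h) ≡ h * (2 * E)
    reorder = solve-∀
  E<2E : E < 2 * E
  E<2E = subst (E <_) (*-comm E 2) (m<m*n E 2 (s<s z<s))
  bound : ∀ d → gcd d m ≡ E → (E ∣ d × ¬ (2 * E ∣ d)) × shiftSolutions m d ≤ 2 * E
  bound d gcd≡E = (gcd≡⇒∣ gcd≡E , 2E∤d)
                , shiftSolutions-≤ {d = d} (2 * E) gcd≡E m≡E2h (trans m≡h2E (*-comm h (2 * E))) ∣-refl (*-cancelˡ-∣ 2)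
    where
    2E∤d : ¬ (2 * E ∣ d)
    2E∤d 2E∣d = <⇒≱ E<2E (∣⇒≤ (subst (2 * E ∣_) gcd≡E (gcd-greatest 2E∣d (subst (2 * E ∣_) (sym m≡h2E) (n∣m*n h)))))

divisorClass-≤ : ∀ m E .{{_ : NonZero E}} → divisorClass m E ≤ 𝟙 (E ∣? m) * m
divisorClass-≤ m E with E ∣? m
... | yes (divides f m≡fE) = ≤-trans (bound (2 ∣? f)) (≤-reflexive (sym (+-identityʳ m)))
  where
  m≡Ef : m ≡ E * f
  m≡Ef = trans m≡fE (*-comm f E)
  bound : Dec (2 ∣ f) → divisorClass m E ≤ m
  bound (yes (divides h f≡h2)) = divisorClass-≤-even m E h (trans m≡Ef (cong (E *_) (trans f≡h2 (*-comm h 2))))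
  bound (no 2∤f)               = divisorClass-≤-odd m E f m≡Ef 2∤f
... | no E∤m = ≤-reflexive (∑-zero m (λ d _ → cong (_* shiftSolutions m d) (𝟙-no (gcd d m ≟ E) (E∤m ∘ gcd≡⇒∣ʳ {d}))))
  where
  gcd≡⇒∣ʳ : ∀ {d} → gcd d m ≡ E → E ∣ m
  gcd≡⇒∣ʳ {d} gcd≡E = subst (_∣ m) gcd≡E (gcd[m,n]∣n d m)

∑-shiftSolutions≡∑-divisorClass : ∀ m .{{_ : NonZero m}} → ∑[ d < m ] shiftSolutions m d ≡ ∑[ e < m ] divisorClass m (suc e)
∑-shiftSolutions≡∑-divisorClass m = trans (∑-cong m (λ d _ → sym (partition d))) (∑-comm m m _)
  where
  partition : ∀ d → ∑[ e < m ] (𝟙 (gcd d m ≟ suc e) * shiftSolutions m d) ≡ shiftSolutions m d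
  partition d = begin
    ∑[ e < m ] (𝟙 (gcd d m ≟ suc e) * shiftSolutions m d)  ≡⟨ ∑-distribʳ-* (shiftSolutions m d) m ⟨
    ∑[ e < m ] 𝟙 (gcd d m ≟ suc e) * shiftSolutions m d    ≡⟨ cong (_* shiftSolutions m d) exactly-one ⟩
    1 * shiftSolutions m d                                 ≡⟨ *-identityˡ (shiftSolutions m d) ⟩
    shiftSolutions m d                                     ∎
    where
    open ≡-Reasoning
    k = gcd d m
    suc-pred-k : suc (ℕ.pred k) ≡ k
    suc-pred-k = suc-pred k {{≢-nonZero (gcd[m,n]≢0 d m (inj₂ (≢-nonZero⁻¹ m)))}}
    exactly-one : ∑[ e < m ] 𝟙 (k ≟ suc e) ≡ 1
    exactly-one = trans (∑-delta m (ℕ.pred k) (<-≤-trans (≤-reflexive suc-pred-k) (gcd[m,n]≤n d m))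
                           (λ e _ e≢ → 𝟙-no (k ≟ suc e) (λ k≡ → e≢ (suc-injective (trans (sym k≡) (sym suc-pred-k))))))
                        (𝟙-yes (k ≟ suc (ℕ.pred k)) (sym suc-pred-k))

∑-shiftSolutions-≤ : ∀ m .{{_ : NonZero m}} → ∑[ d < m ] shiftSolutions m d ≤ τ m * m
∑-shiftSolutions-≤ m = begin
  ∑[ d < m ] shiftSolutions m d        ≡⟨ ∑-shiftSolutions≡∑-divisorClass m ⟩
  ∑[ e < m ] divisorClass m (suc e)    ≤⟨ ∑-mono-≤ m (λ e _ → divisorClass-≤ m (suc e)) ⟩
  ∑[ e < m ] (𝟙 (suc e ∣? m) * m)      ≡⟨ ∑-distribʳ-* m m ⟨
  ∑[ e < m ] 𝟙 (suc e ∣? m) * m        ≡⟨ cong (_* m) (τ≡∑ m) ⟨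
  τ m * m                              ∎
  where open ≤-Reasoning

-- Congruences of integers

-- Opened only here: ℤ's prefix +_ makes ℕ sections such as (x +_) above ambiguous.
open import Data.Integer.Base as ℤ using (+_; ∣_∣)
import Data.Integer.Properties as ℤ
open import Data.Integer.DivMod using (_%ℕ_; _/ℕ_; n%ℕd<d; a≡a%ℕn+[a/ℕn]*n)
import Data.Integer.Divisibility.Signed as ℤ∣
import Data.Integer.Tactic.RingSolver as ℤ-Ring
open import Data.Integer.LCM using (lcm; i∣lcm[i,j]; j∣lcm[i,j])

infix 4 _≡_[mod_] _≡?_[mod_]

-- A record rather than a synonym for q ∣ ∣ u - v ∣, so that u, v and q can be inferred.
record _≡_[mod_] (u v : ℤ) (q : ℕ) : Set where
  constructor ≡-mod
  field divides-difference : q ∣ ∣ u ℤ.- v ∣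
open _≡_[mod_]

_≡?_[mod_] : ∀ u v q → Dec (u ≡ v [mod q ])
u ≡? v [mod q ] = map′ ≡-mod divides-difference (u ≡ v [mod q ]?)

private variable
  u v w : ℤ

≡-mod-sym : u ≡ v [mod q ] → v ≡ u [mod q ]
≡-mod-sym {u} {v} (≡-mod q∣u-v) = ≡-mod (subst (_ ∣_) (ℤ.∣i-j∣≡∣j-i∣ u v) q∣u-v)

≡-mod-trans : u ≡ v [mod q ] → v ≡ w [mod q ] → u ≡ w [mod q ]
≡-mod-trans {u} {v} {q} {w} (≡-mod q∣u-v) (≡-mod q∣v-w) = ≡-mod (ℤ∣.∣⇒∣ᵤ (subst (ℤ∣._∣_ (+ q)) (telescope u v w)
  (ℤ∣.∣m∣n⇒∣m+n (ℤ∣.∣ᵤ⇒∣ {+ q} {u ℤ.- v} q∣u-v) (ℤ∣.∣ᵤ⇒∣ {+ q} {v ℤ.- w} q∣v-w))))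
  where
  telescope : ∀ u v w → (u ℤ.- v) ℤ.+ (v ℤ.- w) ≡ u ℤ.- w
  telescope = ℤ-Ring.solve-∀

≡-mod-respˡ : u ≡ w [mod q ] → (u ≡ v [mod q ] ⇔ w ≡ v [mod q ])
≡-mod-respˡ u≡w = mk⇔ (≡-mod-trans (≡-mod-sym u≡w)) (≡-mod-trans u≡w)

≡-mod-respʳ : v ≡ w [mod q ] → (u ≡ v [mod q ] ⇔ u ≡ w [mod q ])
≡-mod-respʳ v≡w = mk⇔ (λ u≡v → ≡-mod-trans u≡v v≡w) (λ u≡w → ≡-mod-trans u≡w (≡-mod-sym v≡w))

≡-mod-residue : ∀ q .{{_ : NonZero q}} u → u ≡ + (u %ℕ q) [mod q ]
≡-mod-residue q u = ≡-mod (ℤ∣.∣⇒∣ᵤ {+ q} (ℤ∣.divides (u /ℕ q) (begin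
  u ℤ.- + r                       ≡⟨ cong (ℤ._- + r) (a≡a%ℕn+[a/ℕn]*n u q) ⟩
  (+ r ℤ.+ u /ℕ q ℤ.* + q) ℤ.- + r ≡⟨ cancel (+ r) (u /ℕ q ℤ.* + q) ⟩
  u /ℕ q ℤ.* + q                  ∎)))
  where
  open ≡-Reasoning
  r = u %ℕ q
  cancel : ∀ r k → (r ℤ.+ k) ℤ.- r ≡ k
  cancel = ℤ-Ring.solve-∀

∣[+m]-[+n]∣≡∣m-n∣ : ∀ m n → ∣ + m ℤ.- + n ∣ ≡ ℕ.∣ m - n ∣
∣[+m]-[+n]∣≡∣m-n∣ m n with ≤-total m n
... | inj₁ m≤n = trans (cong ∣_∣ (ℤ.[+m]-[+n]≡m⊖n m n)) (trans (ℤ.∣⊖∣-≤ m≤n) (sym (m≤n⇒∣m-n∣≡n∸m m≤n)))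
... | inj₂ n≤m = trans (cong ∣_∣ (ℤ.[+m]-[+n]≡m⊖n m n))
                   (trans (ℤ.∣m⊖n∣≡∣n⊖m∣ m n) (trans (ℤ.∣⊖∣-≤ n≤m) (sym (m≤n⇒∣n-m∣≡n∸m n≤m))))

≡-mod-residue-unique : ∀ {c c′} → c < q → c′ < q → u ≡ + c [mod q ] → u ≡ + c′ [mod q ] → c ≡ c′
≡-mod-residue-unique {q} {u} = ∣∸⇒unique-below (λ {i} {j} i≤j u≡i u≡j →
  subst (q ∣_) (trans (∣[+m]-[+n]∣≡∣m-n∣ i j) (m≤n⇒∣m-n∣≡n∸m i≤j))
        (divides-difference (≡-mod-trans (≡-mod-sym u≡i) u≡j)))

+[n+q*k]≡+n : ∀ n q k → + (n + q * k) ≡ + n [mod q ]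
+[n+q*k]≡+n n q k = ≡-mod (subst (q ∣_) (sym distance) (m∣m*n k))
  where
  distance : ∣ + (n + q * k) ℤ.- + n ∣ ≡ q * k
  distance = trans (∣[+m]-[+n]∣≡∣m-n∣ (n + q * k) n) (trans (∣-∣-comm (n + q * k) n) (∣m-m+n∣≡n n (q * k)))

𝟙-≡-mod-via-residues : ∀ q .{{_ : NonZero q}} u v →
  𝟙 (u ≡? v [mod q ]) ≡ ∑[ c < q ] (𝟙 (u ≡? + c [mod q ]) * 𝟙 (v ≡? + c [mod q ]))
𝟙-≡-mod-via-residues q u v = sym (begin
  ∑[ c < q ] (𝟙 (u ≡? + c [mod q ]) * 𝟙 (v ≡? + c [mod q ])) ≡⟨ ∑-delta q r (n%ℕd<d u q) off-residue ⟩
  𝟙 (u ≡? + r [mod q ]) * 𝟙 (v ≡? + r [mod q ])             ≡⟨ cong (_* 𝟙 (v ≡? + r [mod q ])) (𝟙-yes (u ≡? + r [mod q ]) u≡r) ⟩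
  1 * 𝟙 (v ≡? + r [mod q ])                                 ≡⟨ *-identityˡ _ ⟩
  𝟙 (v ≡? + r [mod q ])                                     ≡⟨ 𝟙-cong v≡r⇔u≡v _ _ ⟩
  𝟙 (u ≡? v [mod q ])                                       ∎)
  where
  open ≡-Reasoning
  r = u %ℕ q
  u≡r : u ≡ + r [mod q ]
  u≡r = ≡-mod-residue q u
  v≡r⇔u≡v : v ≡ + r [mod q ] ⇔ u ≡ v [mod q ]
  v≡r⇔u≡v = mk⇔ (λ v≡r → ≡-mod-trans u≡r (≡-mod-sym v≡r)) (λ u≡v → ≡-mod-trans (≡-mod-sym u≡v) u≡r)
  off-residue : ∀ c → c < q → c ≢ r → 𝟙 (u ≡? + c [mod q ]) * 𝟙 (v ≡? + c [mod q ]) ≡ 0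
  off-residue c c<q c≢r = cong (_* 𝟙 (v ≡? + c [mod q ]))
    (𝟙-no (u ≡? + c [mod q ]) (λ u≡c → c≢r (≡-mod-residue-unique c<q (n%ℕd<d u q) u≡c u≡r)))

-- Collisions

fibre : ℕ → (ℕ → ℤ) → ℕ → ℕ
fibre q U c = ∑[ x < q ] 𝟙 (U x ≡? + c [mod q ])

collisions : ℕ → (ℕ → ℤ) → (ℕ → ℤ) → ℕ
collisions q U V = ∑[ x < q ] ∑[ y < q ] 𝟙 (U x ≡? V y [mod q ])

collisions-via-fibres : ∀ q .{{_ : NonZero q}} U V → collisions q U V ≡ ∑[ c < q ] (fibre q U c * fibre q V c)
collisions-via-fibres q U V = begin
  ∑[ x < q ] ∑[ y < q ] 𝟙 (U x ≡? V y [mod q ])           ≡⟨ ∑-cong q (λ x _ → ∑-cong q (λ y _ → 𝟙-≡-mod-via-residues q (U x) (V y))) ⟩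
  ∑[ x < q ] ∑[ y < q ] ∑[ c < q ] (hit U x c * hit V y c) ≡⟨ ∑-cong q (λ x _ → ∑-comm q q (λ y c → hit U x c * hit V y c)) ⟩
  ∑[ x < q ] ∑[ c < q ] ∑[ y < q ] (hit U x c * hit V y c) ≡⟨ ∑-comm q q _ ⟩
  ∑[ c < q ] ∑[ x < q ] ∑[ y < q ] (hit U x c * hit V y c) ≡⟨ ∑-cong q (λ c _ → ∑-cong q (λ x _ → sym (∑-distribˡ-* (hit U x c) q))) ⟩
  ∑[ c < q ] ∑[ x < q ] (hit U x c * fibre q V c)          ≡⟨ ∑-cong q (λ c _ → sym (∑-distribʳ-* (fibre q V c) q)) ⟩
  ∑[ c < q ] (fibre q U c * fibre q V c)                   ∎
  where
  open ≡-Reasoning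
  hit : (ℕ → ℤ) → ℕ → ℕ → ℕ
  hit W x c = 𝟙 (W x ≡? + c [mod q ])

2mn≤m²+n² : ∀ m n → 2 * (m * n) ≤ m * m + n * n
2mn≤m²+n² m n = [ ≤-below , (λ n≤m → subst₂ _≤_ (cong (2 *_) (*-comm n m)) (+-comm (n * n) (m * m)) (≤-below n≤m)) ]′
                  (≤-total m n)
  where
  square-of-sum : ∀ m t → m * m + (m + t) * (m + t) ≡ 2 * (m * (m + t)) + t * t
  square-of-sum = solve-∀
  ≤-below : ∀ {m n} → m ≤ n → 2 * (m * n) ≤ m * m + n * n
  ≤-below {m} {n} m≤n rewrite sym (m+[n∸m]≡n m≤n) | square-of-sum m (n ∸ m) = m≤m+n _ _

collisions-≤ : ∀ q .{{_ : NonZero q}} U V → 2 * collisions q U V ≤ collisions q U U + collisions q V V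
collisions-≤ q U V = begin
  2 * collisions q U V                                                   ≡⟨ cong (2 *_) (collisions-via-fibres q U V) ⟩
  2 * ∑[ c < q ] (α U c * α V c)                                         ≡⟨ ∑-distribˡ-* 2 q ⟩
  ∑[ c < q ] (2 * (α U c * α V c))                                       ≤⟨ ∑-mono-≤ q (λ c _ → 2mn≤m²+n² (α U c) (α V c)) ⟩
  ∑[ c < q ] (α U c * α U c + α V c * α V c)                             ≡⟨ ∑-distrib-+ q ⟩
  ∑[ c < q ] (α U c * α U c) + ∑[ c < q ] (α V c * α V c)
    ≡⟨ cong₂ _+_ (collisions-via-fibres q U U) (collisions-via-fibres q V V) ⟨
  collisions q U U + collisions q V V                                    ∎
  where
  open ≤-Reasoning
  α : (ℕ → ℤ) → ℕ → ℕ
  α = fibre q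

-- Scaled squares

square : ℕ → ℤ
square x = + (x * x)

square-periodic : ∀ q y → square (q + y) ≡ square y [mod q ]
square-periodic q y = subst (λ n → + n ≡ square y [mod q ]) (sym (expand q y)) (+[n+q*k]≡+n (y * y) q (q + 2 * y))
  where
  expand : ∀ q y → (q + y) * (q + y) ≡ y * y + q * (q + 2 * y)
  expand = solve-∀

∣square-square∣ : ∀ x d → ∣ square x ℤ.- square (x + d) ∣ ≡ d * (2 * x + d)
∣square-square∣ x d = begin
  ∣ square x ℤ.- square (x + d) ∣          ≡⟨ ∣[+m]-[+n]∣≡∣m-n∣ (x * x) ((x + d) * (x + d)) ⟩
  ℕ.∣ x * x - (x + d) * (x + d) ∣          ≡⟨ cong (λ n → ℕ.∣ x * x - n ∣) (expand x d) ⟩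
  ℕ.∣ x * x - x * x + d * (2 * x + d) ∣    ≡⟨ ∣m-m+n∣≡n (x * x) (d * (2 * x + d)) ⟩
  d * (2 * x + d)                          ∎
  where
  open ≡-Reasoning
  expand : ∀ x d → (x + d) * (x + d) ≡ x * x + d * (2 * x + d)
  expand = solve-∀

squarePairs : ℕ → ℕ
squarePairs m = collisions m square square

squarePairs≡∑-shiftSolutions : ∀ m → squarePairs m ≡ ∑[ d < m ] shiftSolutions m d
squarePairs≡∑-shiftSolutions m = begin
  ∑[ x < m ] ∑[ y < m ] hit x y                              ≡⟨ ∑-cong m (λ x _ → ∑-rotate m x (periodic x)) ⟨
  ∑[ x < m ] ∑[ d < m ] hit x (x + d)                        ≡⟨ ∑-cong m (λ x _ → ∑-cong m (λ d _ → 𝟙-cong (distance x d) _ _)) ⟩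
  ∑[ x < m ] ∑[ d < m ] 𝟙 (m ∣? d * (2 * x + d))             ≡⟨ ∑-comm m m _ ⟩
  ∑[ d < m ] shiftSolutions m d                              ∎
  where
  open ≡-Reasoning
  hit : ℕ → ℕ → ℕ
  hit x y = 𝟙 (square x ≡? square y [mod m ])
  periodic : ∀ x → Periodic m (hit x)
  periodic x y = 𝟙-cong (≡-mod-respʳ (square-periodic m y)) _ _
  distance : ∀ x d → square x ≡ square (x + d) [mod m ] ⇔ m ∣ d * (2 * x + d)
  distance x d = mk⇔ (λ (≡-mod m∣) → subst (m ∣_) (∣square-square∣ x d) m∣)
                     (λ m∣ → ≡-mod (subst (m ∣_) (sym (∣square-square∣ x d)) m∣))

squarePairs-≤ : ∀ m .{{_ : NonZero m}} → squarePairs m ≤ τ m * m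
squarePairs-≤ m = subst (_≤ τ m * m) (sym (squarePairs≡∑-shiftSolutions m)) (∑-shiftSolutions-≤ m)

scaledSquare : ℤ → ℕ → ℤ
scaledSquare a x = a ℤ.* + x ℤ.* + x

scaledSquare-≡-mod⇔ : ∀ {q g q′} a x y .{{_ : NonZero g}} → gcd ∣ a ∣ q ≡ g → q ≡ g * q′ →
                      scaledSquare a x ≡ scaledSquare a y [mod q ] ⇔ square x ≡ square y [mod q′ ]
scaledSquare-≡-mod⇔ {q} {g} {q′} a x y gcd≡g q≡gq′ = mk⇔
  (λ (≡-mod q∣) → ≡-mod (Equivalence.to   (∣*⇔cofactor∣ {∣ a ∣} z gcd≡g q≡gq′) (subst (q ∣_) distance q∣)))
  (λ (≡-mod q′∣) → ≡-mod (subst (q ∣_) (sym distance) (Equivalence.from (∣*⇔cofactor∣ {∣ a ∣} z gcd≡g q≡gq′) q′∣)))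
  where
  z : ℕ
  z = ∣ square x ℤ.- square y ∣
  factor : ∀ a X Y → a ℤ.* X ℤ.* X ℤ.- a ℤ.* Y ℤ.* Y ≡ a ℤ.* (X ℤ.* X ℤ.- Y ℤ.* Y)
  factor = ℤ-Ring.solve-∀
  distance : ∣ scaledSquare a x ℤ.- scaledSquare a y ∣ ≡ ∣ a ∣ * z
  distance = trans (cong ∣_∣ (trans (factor a (+ x) (+ y)) (cong (a ℤ.*_) (sym (cong₂ ℤ._-_ (ℤ.pos-* x x) (ℤ.pos-* y y))))))
                   (ℤ.abs-* a _)

collisions-scaledSquare≡ : ∀ {q g q′} a .{{_ : NonZero g}} → gcd ∣ a ∣ q ≡ g → q ≡ g * q′ →
                           collisions q (scaledSquare a) (scaledSquare a) ≡ g * (g * squarePairs q′)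
collisions-scaledSquare≡ {q} {g} {q′} a gcd≡g q≡gq′ = begin
  ∑[ x < q ] ∑[ y < q ] 𝟙 (scaledSquare a x ≡? scaledSquare a y [mod q ])
    ≡⟨ ∑-cong q (λ x _ → ∑-cong q (λ y _ → 𝟙-cong (scaledSquare-≡-mod⇔ a x y gcd≡g q≡gq′) _ _)) ⟩
  ∑[ x < q ] ∑[ y < q ] hit x y            ≡⟨ cong (λ n → ∑[ x < n ] ∑[ y < n ] hit x y) q≡gq′ ⟩
  ∑[ x < g * q′ ] ∑[ y < g * q′ ] hit x y  ≡⟨ ∑∑-periodic q′ g hit periodicʸ periodicˣ ⟩
  g * (g * squarePairs q′)                 ∎
  where
  open ≡-Reasoning
  hit : ℕ → ℕ → ℕ
  hit x y = 𝟙 (square x ≡? square y [mod q′ ])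
  periodicʸ : ∀ x → Periodic q′ (hit x)
  periodicʸ x y = 𝟙-cong (≡-mod-respʳ (square-periodic q′ y)) _ _
  periodicˣ : ∀ y → Periodic q′ (λ x → hit x y)
  periodicˣ y x = 𝟙-cong (≡-mod-respˡ (square-periodic q′ x)) _ _

collisions-scaledSquare-≤ : ∀ a c q .{{_ : NonZero q}} → ∣ a ∣ ∣ c →
                            collisions q (scaledSquare a) (scaledSquare a) ≤ gcd c q * q * τ q
collisions-scaledSquare-≤ a c q a∣c = begin
  collisions q (scaledSquare a) (scaledSquare a)  ≡⟨ collisions-scaledSquare≡ a refl q≡gq′ ⟩
  g * (g * squarePairs q′)                        ≤⟨ *-monoʳ-≤ g (*-monoʳ-≤ g squarePairs-q′-≤) ⟩
  g * (g * (τ q * q′))                            ≡⟨ rearrange g (τ q) q′ ⟩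
  g * (g * q′) * τ q                              ≡⟨ cong (λ n → g * n * τ q) q≡gq′ ⟨
  g * q * τ q                                     ≤⟨ *-monoˡ-≤ (τ q) (*-monoˡ-≤ q g≤gcd[c,q]) ⟩
  gcd c q * q * τ q                               ∎
  where
  open ≤-Reasoning
  g : ℕ
  g = gcd ∣ a ∣ q
  g∣q : g ∣ q
  g∣q = gcd[m,n]∣n ∣ a ∣ q
  q′ : ℕ
  q′ = quotient g∣q
  q≡gq′ : q ≡ g * q′
  q≡gq′ = m∣n⇒n≡m*quotient g∣q
  instance
    g≢0 : NonZero g
    g≢0 = ≢-nonZero (gcd[m,n]≢0 ∣ a ∣ q (inj₂ (≢-nonZero⁻¹ q)))
    q′≢0 : NonZero q′
    q′≢0 = quotient≢0 g∣q
    gcd[c,q]≢0 : NonZero (gcd c q)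
    gcd[c,q]≢0 = ≢-nonZero (gcd[m,n]≢0 c q (inj₂ (≢-nonZero⁻¹ q)))
  squarePairs-q′-≤ : squarePairs q′ ≤ τ q * q′
  squarePairs-q′-≤ = ≤-trans (squarePairs-≤ q′) (*-monoˡ-≤ q′ (τ-mono-∣ (quotient-∣ g∣q)))
  g≤gcd[c,q] : g ≤ gcd c q
  g≤gcd[c,q] = ∣⇒≤ (gcd-greatest (∣-trans (gcd[m,n]∣m ∣ a ∣ q) a∣c) g∣q)
  rearrange : ∀ g t q′ → g * (g * (t * q′)) ≡ g * (g * q′) * t
  rearrange = solve-∀

N≡collisions : ∀ a b q → N a b q ≡ collisions q (scaledSquare a) (scaledSquare b)
N≡collisions a b q = begin
  N a b q
    ≡⟨ length-filter≡sum-𝟙 _ (cartesianProduct (allFin q) (allFin q)) ⟩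
  sum (map (λ (x , y) → hit (toℕ x) (toℕ y)) (cartesianProduct (allFin q) (allFin q)))
    ≡⟨ sum-map-cartesianProduct (λ (x , y) → hit (toℕ x) (toℕ y)) (allFin q) (allFin q) ⟩
  sum (map (λ x → sum (map (λ y → hit (toℕ x) (toℕ y)) (allFin q))) (allFin q))
    ≡⟨ cong sum (map-cong (λ x → sum-map-allFin q (hit (toℕ x))) (allFin q)) ⟩
  sum (map (λ x → ∑< q (hit (toℕ x))) (allFin q))                          ≡⟨ sum-map-allFin q (λ x → ∑< q (hit x)) ⟩
  ∑[ x < q ] ∑[ y < q ] hit x y
    ≡⟨ ∑-cong q (λ x _ → ∑-cong q (λ y _ → 𝟙-cong (mk⇔ ≡-mod divides-difference) _ _)) ⟩
  collisions q (scaledSquare a) (scaledSquare b)                           ∎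
  where
  open ≡-Reasoning
  hit : ℕ → ℕ → ℕ
  hit x y = 𝟙 (scaledSquare a x ≡ scaledSquare b y [mod q ]?)

lemma9p1 : (a b : ℤ) (q : ℕ) → 1 ≤ q →
    N a b q ≤ lcmGcd a b q * q * τ q
lemma9p1 a b q@(suc _) _ = *-cancelˡ-≤ 2 (begin
  2 * N a b q                                                 ≡⟨ cong (2 *_) (N≡collisions a b q) ⟩
  2 * collisions q (scaledSquare a) (scaledSquare b)          ≤⟨ collisions-≤ q (scaledSquare a) (scaledSquare b) ⟩
  collisions q (scaledSquare a) (scaledSquare a) + collisions q (scaledSquare b) (scaledSquare b)
    ≤⟨ +-mono-≤ (collisions-scaledSquare-≤ a ∣ lcm a b ∣ q (i∣lcm[i,j] a b))
                (collisions-scaledSquare-≤ b ∣ lcm a b ∣ q (j∣lcm[i,j] a b)) ⟩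
  L + L                                                       ≡⟨ cong₂ _+_ refl (+-identityʳ L) ⟨
  2 * L                                                       ∎)
  where
  open ≤-Reasoning
  L : ℕ
  L = lcmGcd a b q * q * τ q
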